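{- Let $G$ be a threshold graph with $s=\mathrm{seq}(G)=s_1\dots s_{n-1}$, and suppose $s$ contains at least two ones. Then the length $\psi(G)$ of a longest cycle in $G$ satisfies $$\psi(G)=r(s)+1-h(s'),\qquad\text{where } s'=s_1s_2\dots s_{r(s)-1}.$$
   Context: A threshold graph on $n$ vertices is built from a single base vertex by adding $n-1$ vertices one at a time, each either isolated or dominating (adjacent to all existing vertices); its creation sequence $\mathrm{seq}(G)=s_1\dots s_{n-1}$ has $s_i=1$ if the $i$-th added vertex was dominating and $s_i=0$ if isolated. For a binary sequence $s$ of length $m$ and $0\le k\le m$, let $z_k(s)$ and $u_k(s)$ be the numbers of zeros and ones among the last $k$ digits of $s$, and $h(s)=\max_{0\le k\le m}\{z_k(s)-u_k(s)\}$. For $s=s_1\dots s_m$, $r(s)=\max(\{0\}\cup\{i: s_i=1\})$, the index of the right-most one (or $0$ if none). -}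

module Defs where

open import Data.Bool using (Bool; true; false)
open import Data.Nat using (ℕ; zero; suc; _⊔_; _∸_; _≤_)
open import Data.Integer as ℤ using (ℤ; +_; _-_)
open import Data.Fin using (Fin; toℕ)
open import Data.List using (List; []; _∷_; length; take)
open import Data.List.Relation.Unary.Unique.Propositional using (Unique)
open import Data.List.Relation.Unary.Linked using (Linked)
open import Data.Product using (_×_; Σ; ∃)
open import Data.Empty using (⊥)
open import Relation.Binary.PropositionalEquality using (_≡_; _≢_)

zeros : List Bool → ℕ
zeros []           = 0
zeros (false ∷ xs) = suc (zeros xs)
zeros (true  ∷ xs) = zeros xs

ones : List Bool → ℕ
ones []           = 0
ones (false ∷ xs) = ones xs
ones (true  ∷ xs) = suc (ones xs)

h : List Bool → ℤ
h []       = + 0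
h (x ∷ xs) = ((+ zeros (x ∷ xs)) - (+ ones (x ∷ xs))) ℤ.⊔ h xs

-- r(s): 1-based index of the right-most one, or 0 if there is none
rFrom : ℕ → List Bool → ℕ
rFrom i []           = 0
rFrom i (false ∷ xs) = rFrom (suc i) xs
rFrom i (true  ∷ xs) = i ⊔ rFrom (suc i) xs

r : List Bool → ℕ
r = rFrom 1

-- The threshold graph with creation sequence s = s₁…s_{n-1}
-- Vertices: Fin n, n = length s + 1; vertex 0 is the base vertex and
-- vertex j (1 ≤ j ≤ n-1) is the j-th added vertex.

-- digit s_j (1-based); value at 0 is irrelevant
digit : List Bool → ℕ → Bool
digit []       _             = false
digit (x ∷ xs) zero          = false
digit (x ∷ xs) (suc zero)    = x
digit (x ∷ xs) (suc (suc j)) = digit xs (suc j)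

-- two distinct vertices a, b are adjacent iff the later-added one,
-- vertex max(a,b), was added as a dominating vertex
Adj : (s : List Bool) → Fin (suc (length s)) → Fin (suc (length s)) → Set
Adj s a b = a ≢ b × digit s (toℕ a ⊔ toℕ b) ≡ true

lastOr : {V : Set} → V → List V → V
lastOr v []       = v
lastOr v (w ∷ ws) = lastOr w ws

Closes : {V : Set} → (V → V → Set) → List V → Set
Closes E []       = ⊥
Closes E (v ∷ ws) = E (lastOr v ws) v

IsCycle : {V : Set} → (V → V → Set) → List V → Set
IsCycle E vs = (3 ≤ length vs) × Unique vs × Linked E vs × Closes E vs

IsLongestCycleLength : {V : Set} → (V → V → Set) → ℕ → Set
IsLongestCycleLength {V} E L =
  Σ (List V) (λ vs → IsCycle E vs × length vs ≡ L)
  × ((vs : List V) → IsCycle E vs → length vs ≤ L)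

module Submission where

-- Write s = a 1 b with b free of ones, so that r(s) = |a| + 1, s′ = a, and vertex
-- r(s) is adjacent to all of 0 … |a|.
--
-- A cycle of length |a| + 2 − h(a): scan the vertices 0 … |a| keeping a path and a
-- pool of unused vertices. An isolated vertex joins the pool; a dominating one,
-- adjacent to everything before it, extends the path and is followed by one pool
-- vertex if the pool is non-empty. The pool size then follows the recursion of h
-- along the prefix read so far, so the final path has |a| + 1 − h(a) vertices, and
-- vertex r(s) closes it into a cycle.
--
-- No longer cycle: split a = p q and call the vertices 0 … |p| low; a later vertex
-- is dominating or isolated according to its digit. An isolated vertex has only
-- dominating neighbours, and every neighbour of a low vertex is low or dominating.
-- Walking around a cycle, each isolated vertex and each exit from the low vertices
-- is therefore followed by a distinct dominating vertex, of which there are at most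
-- ones(q) + 1; and a cycle meeting both low and other vertices exits at least once.
-- With at most |p| + 1 low vertices, a cycle thus has at most
-- |p| + 2 ones(q) + 2 = |a| + 2 − (zeros(q) − ones(q)) vertices; maximising over q
-- gives |a| + 2 − h(a).

open import Data.Bool using (Bool; true; false; if_then_else_)
open import Data.Empty using (⊥-elim)
open import Data.Fin as Fin using (Fin; toℕ; fromℕ<)
open import Data.Fin.Properties using (toℕ-fromℕ<; toℕ-injective)
open import Data.Integer as ℤ using (ℤ; +_; _-_; _⊔_; 0ℤ; 1ℤ)
open import Data.Integer.Properties as ℤ using ()
open import Data.Integer.Tactic.RingSolver using (solve-∀)
open import Data.List using (List; []; _∷_; _++_; _∷ʳ_; length; take; map; upTo)
open import Data.List.Membership.Propositional using (_∈_)
open import Data.List.Membership.Propositional.Properties using (∈-applyUpTo⁺)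
open import Data.List.Properties using (map-++; ++-assoc; length-map; length-++; length-upTo)
open import Data.List.Relation.Unary.All as All using (All; []; _∷_; all?)
open import Data.List.Relation.Unary.All.Properties using (¬All⇒Any¬)
open import Data.List.Relation.Unary.AllPairs using ([]; _∷_)
open import Data.List.Relation.Unary.Any using (Any; here; there; any?)
import Data.List.Relation.Unary.Any.Properties as Any
open import Data.List.Relation.Unary.Linked as Linked using (Linked; []; [-]; _∷_)
import Data.List.Relation.Unary.Linked.Properties as Linked
open import Data.List.Relation.Unary.Unique.Propositional using (Unique)
import Data.List.Relation.Unary.Unique.Propositional.Properties as Unique
open import Data.Nat as ℕ using (ℕ; zero; suc; _∸_; _≤_; _<_; z≤n; s≤s; _+_)
open import Data.Nat.Properties as ℕ using ()
open import Algebra.Properties.CommutativeSemigroup ℕ.+-commutativeSemigroup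
  using (interchange; x∙yz≈y∙xz)
open import Data.Nat.Tactic.RingSolver renaming (solve-∀ to ℕ-solve-∀)
open import Data.Product using (Σ; _×_; _,_; proj₁; proj₂)
open import Data.Sum using (inj₁; inj₂)
open import Function using (_∘_; id)
open import Relation.Binary.Definitions using (DecidableEquality)
open import Relation.Binary.PropositionalEquality
open import Relation.Nullary using (Dec; yes; no; does; ¬_)

open import Defs

Linked-∷ʳ : ∀ {A : Set} {R : A → A → Set} {x y} xs →
            Linked R (x ∷ xs) → R (lastOr x xs) y → Linked R (x ∷ (xs ∷ʳ y))
Linked-∷ʳ []       [-]     Rxy = Rxy ∷ [-]
Linked-∷ʳ (_ ∷ xs) (r ∷ rs) Rxy = r ∷ Linked-∷ʳ xs rs Rxy

All-lastOr : ∀ {A : Set} {P : A → Set} x xs → All P (x ∷ xs) → P (lastOr x xs)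
All-lastOr x []       (px ∷ [])  = px
All-lastOr x (y ∷ ys) (_  ∷ pys) = All-lastOr y ys pys

lastOr-map : ∀ {A B : Set} (f : A → B) x xs → lastOr (f x) (map f xs) ≡ f (lastOr x xs)
lastOr-map f x []       = refl
lastOr-map f x (y ∷ ys) = lastOr-map f y ys

take-length-++ : ∀ {A : Set} (xs ys : List A) → take (length xs) (xs ++ ys) ≡ xs
take-length-++ []       ys = refl
take-length-++ (x ∷ xs) ys = cong (x ∷_) (take-length-++ xs ys)

∈-remove : ∀ {A : Set} {x : A} {ys} → x ∈ ys →
           Σ (List A) λ ys' → length ys ≡ suc (length ys') × (∀ {y} → y ∈ ys → y ≢ x → y ∈ ys')
∈-remove {ys = _ ∷ ys} (here refl) =
  ys , refl , λ { (here y≡x) y≢x → ⊥-elim (y≢x y≡x) ; (there y∈) _ → y∈ }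
∈-remove {ys = y ∷ ys} (there x∈ys) with ys' , length≡ , keep ← ∈-remove x∈ys =
  y ∷ ys' , cong suc length≡ , λ { (here y≡) _ → here y≡ ; (there z∈) z≢x → there (keep z∈ z≢x) }

+-mono-≤-interchange : ∀ a b d e {c f} → a + b ≤ c → d + e ≤ f → (a + d) + (b + e) ≤ c + f
+-mono-≤-interchange a b d e {c} {f} ab≤c de≤f =
  subst (_≤ c + f) (interchange a b d e) (ℕ.+-mono-≤ ab≤c de≤f)

+-distribʳ-⊔ : ∀ k i j → (i ⊔ j) ℤ.+ k ≡ (i ℤ.+ k) ⊔ (j ℤ.+ k)
+-distribʳ-⊔ k = ℤ.mono-<-distrib-⊔ (ℤ._+ k) (ℤ.+-monoˡ-< k)

i≤j-k⇒k≤j-i : ∀ {i j k} → i ℤ.≤ j - k → k ℤ.≤ j - i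
i≤j-k⇒k≤j-i {i} {j} {k} i≤j-k =
  subst₂ ℤ._≤_ (simplifyˡ i k) (simplifyʳ i j k) (ℤ.+-monoˡ-≤ (k - i) i≤j-k)
  where
    simplifyˡ : ∀ (i k : ℤ) → i ℤ.+ (k - i) ≡ k
    simplifyˡ = solve-∀
    simplifyʳ : ∀ (i j k : ℤ) → (j - k) ℤ.+ (k - i) ≡ j - i
    simplifyʳ = solve-∀

+[m+n]-n≡m : ∀ m n → + (m + n) - + n ≡ + m
+[m+n]-n≡m m n = trans (cong (_- + n) (ℤ.pos-+ m n)) (cancel (+ m) (+ n))
  where
    cancel : ∀ (i j : ℤ) → (i ℤ.+ j) - j ≡ i
    cancel = solve-∀

-- The statistic h

zeros-++ : ∀ xs ys → zeros (xs ++ ys) ≡ zeros xs + zeros ys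
zeros-++ []           ys = refl
zeros-++ (false ∷ xs) ys = cong suc (zeros-++ xs ys)
zeros-++ (true  ∷ xs) ys = zeros-++ xs ys

ones-++ : ∀ xs ys → ones (xs ++ ys) ≡ ones xs + ones ys
ones-++ []           ys = refl
ones-++ (false ∷ xs) ys = ones-++ xs ys
ones-++ (true  ∷ xs) ys = cong suc (ones-++ xs ys)

zeros+ones≡length : ∀ xs → zeros xs + ones xs ≡ length xs
zeros+ones≡length []           = refl
zeros+ones≡length (false ∷ xs) = cong suc (zeros+ones≡length xs)
zeros+ones≡length (true  ∷ xs) =
  trans (ℕ.+-suc (zeros xs) (ones xs)) (cong suc (zeros+ones≡length xs))

ones-∷ʳ-false : ∀ w → ones (w ∷ʳ false) ≡ ones w
ones-∷ʳ-false w = trans (ones-++ w (false ∷ [])) (ℕ.+-identityʳ (ones w))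

ones-++-true∷ : ∀ a b → ones b ≡ 0 → ones (a ++ true ∷ b) ≡ suc (ones a)
ones-++-true∷ a b no-ones =
  trans (ones-++ a (true ∷ b)) (trans (cong (λ n → ones a + suc n) no-ones) (ℕ.+-comm (ones a) 1))

excess : List Bool → ℤ
excess w = + zeros w - + ones w

excess-∷ʳ-true : ∀ w → excess (w ∷ʳ true) ≡ excess w - 1ℤ
excess-∷ʳ-true w
  rewrite zeros-++ w (true ∷ []) | ones-++ w (true ∷ [])
        | ℕ.+-identityʳ (zeros w) | ℤ.pos-+ (ones w) 1
  = identity (+ zeros w) (+ ones w)
  where identity : ∀ (z o : ℤ) → z - (o ℤ.+ 1ℤ) ≡ (z - o) - 1ℤ
        identity = solve-∀

excess-∷ʳ-false : ∀ w → excess (w ∷ʳ false) ≡ excess w ℤ.+ 1ℤ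
excess-∷ʳ-false w
  rewrite zeros-++ w (false ∷ []) | ones-++ w (false ∷ [])
        | ℕ.+-identityʳ (ones w) | ℤ.pos-+ (zeros w) 1
  = identity (+ zeros w) (+ ones w)
  where identity : ∀ (z o : ℤ) → (z ℤ.+ 1ℤ) - o ≡ (z - o) ℤ.+ 1ℤ
        identity = solve-∀

h-∷ʳ-true : ∀ w → h (w ∷ʳ true) ≡ (h w - 1ℤ) ⊔ 0ℤ
h-∷ʳ-true []      = refl
h-∷ʳ-true (x ∷ w) = begin
  excess ((x ∷ w) ∷ʳ true) ⊔ h (w ∷ʳ true)
    ≡⟨ cong₂ _⊔_ (excess-∷ʳ-true (x ∷ w)) (h-∷ʳ-true w) ⟩
  (excess (x ∷ w) - 1ℤ) ⊔ ((h w - 1ℤ) ⊔ 0ℤ)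
    ≡⟨ sym (ℤ.⊔-assoc (excess (x ∷ w) - 1ℤ) _ _) ⟩
  ((excess (x ∷ w) - 1ℤ) ⊔ (h w - 1ℤ)) ⊔ 0ℤ
    ≡⟨ cong (_⊔ 0ℤ) (sym (+-distribʳ-⊔ (ℤ.- 1ℤ) (excess (x ∷ w)) (h w))) ⟩
  ((excess (x ∷ w) ⊔ h w) - 1ℤ) ⊔ 0ℤ ∎
  where open ≡-Reasoning

h-∷ʳ-false : ∀ w → h (w ∷ʳ false) ≡ h w ℤ.+ 1ℤ
h-∷ʳ-false []      = refl
h-∷ʳ-false (x ∷ w) = begin
  excess ((x ∷ w) ∷ʳ false) ⊔ h (w ∷ʳ false)
    ≡⟨ cong₂ _⊔_ (excess-∷ʳ-false (x ∷ w)) (h-∷ʳ-false w) ⟩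
  (excess (x ∷ w) ℤ.+ 1ℤ) ⊔ (h w ℤ.+ 1ℤ)
    ≡⟨ sym (+-distribʳ-⊔ 1ℤ (excess (x ∷ w)) (h w)) ⟩
  (excess (x ∷ w) ⊔ h w) ℤ.+ 1ℤ ∎
  where open ≡-Reasoning

h-∷ʳ-true-pred : ∀ w n → h w ≡ + n → h (w ∷ʳ true) ≡ + (n ∸ 1)
h-∷ʳ-true-pred w n hw≡n =
  trans (h-∷ʳ-true w) (trans (cong (λ i → (i - 1ℤ) ⊔ 0ℤ) hw≡n) (drop-negative n))
  where
    drop-negative : ∀ n → (+ n - 1ℤ) ⊔ 0ℤ ≡ + (n ∸ 1)
    drop-negative zero    = refl
    drop-negative (suc n) = ℤ.i≥j⇒i⊔j≡i (ℤ.+≤+ z≤n)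

h-lub : ∀ {c} w → (∀ p q → w ≡ p ++ q → excess q ℤ.≤ c) → h w ℤ.≤ c
h-lub []      bound = bound [] [] refl
h-lub (x ∷ w) bound =
  ℤ.⊔-lub (bound [] (x ∷ w) refl)
          (h-lub w (λ p q w≡p++q → bound (x ∷ p) q (cong (x ∷_) w≡p++q)))

take-suc : ∀ (s : List Bool) m → suc m ≤ length s → take (suc m) s ≡ take m s ∷ʳ digit s (suc m)
take-suc (x ∷ xs) zero    _       = refl
take-suc (x ∷ xs) (suc m) (s≤s q) = cong (x ∷_) (take-suc xs m q)

digit-after-prefix : ∀ xs (y : Bool) ys → digit (xs ++ y ∷ ys) (suc (length xs)) ≡ y
digit-after-prefix []       y ys = refl
digit-after-prefix (x ∷ xs) y ys = digit-after-prefix xs y ys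

rFrom-ones≡0 : ∀ i xs → ones xs ≡ 0 → rFrom i xs ≡ 0
rFrom-ones≡0 i []           _      = refl
rFrom-ones≡0 i (false ∷ xs) ones≡0 = rFrom-ones≡0 (suc i) xs ones≡0

record LastOneSplit (i : ℕ) (s : List Bool) : Set where
  constructor lastOneSplit
  field
    before   : List Bool
    after    : List Bool
    split    : s ≡ before ++ true ∷ after
    no-ones  : ones after ≡ 0
    position : rFrom (suc i) s ≡ suc (i + length before)

last-one-split : ∀ i s → 1 ≤ ones s → LastOneSplit i s
last-one-split i (false ∷ xs) has-one
  with lastOneSplit a b split no-ones position ← last-one-split (suc i) xs has-one
  = lastOneSplit (false ∷ a) b (cong (false ∷_) split) no-ones
      (trans position (cong suc (sym (ℕ.+-suc i (length a)))))
last-one-split i (true ∷ xs) _ with ones xs ℕ.≟ 0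
... | yes ones≡0 = lastOneSplit [] xs refl ones≡0 (begin
  suc i ℕ.⊔ rFrom (suc (suc i)) xs ≡⟨ cong (suc i ℕ.⊔_) (rFrom-ones≡0 _ xs ones≡0) ⟩
  suc i ℕ.⊔ 0                      ≡⟨ ℕ.⊔-identityʳ (suc i) ⟩
  suc i                            ≡⟨ cong suc (sym (ℕ.+-identityʳ i)) ⟩
  suc (i + 0)                      ∎)
  where open ≡-Reasoning
... | no ones≢0
  with lastOneSplit a b split no-ones position ← last-one-split (suc i) xs (ℕ.n≢0⇒n>0 ones≢0)
  = lastOneSplit (true ∷ a) b (cong (true ∷_) split) no-ones (begin
  suc i ℕ.⊔ rFrom (suc (suc i)) xs ≡⟨ cong (suc i ℕ.⊔_) position ⟩
  suc i ℕ.⊔ suc (suc i + length a) ≡⟨ ℕ.m≤n⇒m⊔n≡n (s≤s (ℕ.m≤n⇒m≤1+n (ℕ.m≤m+n i (length a)))) ⟩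
  suc (suc i + length a)           ≡⟨ cong suc (sym (ℕ.+-suc i (length a))) ⟩
  suc (i + length (true ∷ a))      ∎)
  where open ≡-Reasoning

-- A cycle of length r(s) + 1 − h(s′)

Vertex : List Bool → Set
Vertex s = Fin (suc (length s))

Edge : List Bool → ℕ → ℕ → Set
Edge s u v = digit s (u ℕ.⊔ v) ≡ true

module _ (s : List Bool) where

  Adj-sym : ∀ {u v} → Adj s u v → Adj s v u
  Adj-sym {u} {v} (u≢v , edge) =
    u≢v ∘ sym , subst (λ n → digit s n ≡ true) (ℕ.⊔-comm (toℕ u) (toℕ v)) edge

  Adj-dominating : ∀ {u v : Vertex s} → digit s (toℕ u) ≡ true → toℕ v < toℕ u → Adj s u v
  Adj-dominating {u} {v} u-digit v<u =
    (λ u≡v → ℕ.<-irrefl (cong toℕ (sym u≡v)) v<u) ,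
    trans (cong (digit s) (ℕ.m≥n⇒m⊔n≡m (ℕ.<⇒≤ v<u))) u-digit

  Adj-new-dominating : ∀ {m} {w v : Vertex s} → toℕ w ≡ suc m → digit s (suc m) ≡ true →
                       toℕ v ≤ m → Adj s w v
  Adj-new-dominating {v = v} w≡1+m w-dominating v≤m =
    Adj-dominating (trans (cong (digit s) w≡1+m) w-dominating)
                   (subst (toℕ v <_) (sym w≡1+m) (s≤s v≤m))

  Bounded : ℕ → List (Vertex s) → Set
  Bounded m = All (λ v → toℕ v ≤ m)

  new≢old : ∀ {m} {u v : Vertex s} → toℕ u ≡ suc m → toℕ v ≤ m → u ≢ v
  new≢old {v = v} u≡1+m v≤m u≡v =
    ℕ.<-irrefl (cong toℕ (sym u≡v)) (subst (toℕ v <_) (sym u≡1+m) (s≤s v≤m))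

  old≢new : ∀ {m} {u v : Vertex s} → toℕ u ≡ suc m → toℕ v ≤ m → v ≢ u
  old≢new u≡1+m v≤m = new≢old u≡1+m v≤m ∘ sym

  record PathWithPool (m : ℕ) : Set where
    constructor pathWithPool
    field
      end           : Vertex s
      rest          : List (Vertex s)
      pool          : List (Vertex s)
      path-unique   : Unique (end ∷ rest)
      pool-unique   : Unique pool
      pool-off-path : All (λ o → All (o ≢_) (end ∷ rest)) pool
      path-bounded  : Bounded m (end ∷ rest)
      pool-bounded  : Bounded m pool
      path-linked   : Linked (Adj s) (end ∷ rest)
      covers        : length (end ∷ rest) + length pool ≡ suc m
      pool-size     : + length pool ≡ h (take m s)
      path-long     : suc (ones (take m s)) ≤ length (end ∷ rest)

  Bounded-suc : ∀ {m vs} → Bounded m vs → Bounded (suc m) vs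
  Bounded-suc = All.map ℕ.m≤n⇒m≤1+n

  extend-isolated : ∀ {m} → PathWithPool m → (w : Vertex s) → toℕ w ≡ suc m →
                    take (suc m) s ≡ take m s ∷ʳ false → PathWithPool (suc m)
  extend-isolated {m} P w w≡1+m prefix = record
    { end           = end
    ; rest          = rest
    ; pool          = w ∷ pool
    ; path-unique   = path-unique
    ; pool-unique   = All.map (new≢old w≡1+m) pool-bounded ∷ pool-unique
    ; pool-off-path = All.map (new≢old w≡1+m) path-bounded ∷ pool-off-path
    ; path-bounded  = Bounded-suc path-bounded
    ; pool-bounded  = ℕ.≤-reflexive w≡1+m ∷ Bounded-suc pool-bounded
    ; path-linked   = path-linked
    ; covers        = trans (ℕ.+-suc (length (end ∷ rest)) (length pool)) (cong suc covers)
    ; pool-size     = begin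
        + suc (length pool)          ≡⟨ cong +_ (ℕ.+-comm 1 (length pool)) ⟩
        + (length pool + 1)          ≡⟨ ℤ.pos-+ (length pool) 1 ⟩
        + length pool ℤ.+ 1ℤ         ≡⟨ cong (ℤ._+ 1ℤ) pool-size ⟩
        h (take m s) ℤ.+ 1ℤ          ≡⟨ sym (h-∷ʳ-false (take m s)) ⟩
        h (take m s ∷ʳ false)        ≡⟨ cong h (sym prefix) ⟩
        h (take (suc m) s)           ∎
    ; path-long     = subst (λ n → suc n ≤ length (end ∷ rest))
                        (sym (trans (cong ones prefix) (ones-∷ʳ-false (take m s)))) path-long
    }
    where
      open PathWithPool P
      open ≡-Reasoning

  extend-dominating : ∀ {m} → PathWithPool m → (w : Vertex s) → toℕ w ≡ suc m →
                      (∀ {v} → toℕ v ≤ m → Adj s w v) →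
                      take (suc m) s ≡ take m s ∷ʳ true → PathWithPool (suc m)
  extend-dominating {m}
    (pathWithPool end rest [] path-unique _ _ path-bounded _ path-linked covers pool-size path-long)
    w w≡1+m w-adj prefix = record
    { end           = w
    ; rest          = end ∷ rest
    ; pool          = []
    ; path-unique   = All.map (new≢old w≡1+m) path-bounded ∷ path-unique
    ; pool-unique   = []
    ; pool-off-path = []
    ; path-bounded  = ℕ.≤-reflexive w≡1+m ∷ Bounded-suc path-bounded
    ; pool-bounded  = []
    ; path-linked   = w-adj (All.head path-bounded) ∷ path-linked
    ; covers        = cong suc covers
    ; pool-size     = sym (trans (cong h prefix) (h-∷ʳ-true-pred (take m s) 0 (sym pool-size)))
    ; path-long     = subst (λ n → n ≤ length (w ∷ end ∷ rest))
                        (sym (cong suc (trans (cong ones prefix) (ones-++-true∷ (take m s) [] refl))))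
                        (s≤s path-long)
    }
  extend-dominating {m}
    (pathWithPool end rest (o ∷ pool) path-unique (o∉pool ∷ pool-unique) (o∉path ∷ pool-off-path)
                  path-bounded (o≤m ∷ pool-bounded) path-linked covers pool-size path-long)
    w w≡1+m w-adj prefix = record
    { end           = o
    ; rest          = w ∷ end ∷ rest
    ; pool          = pool
    ; path-unique   = (old≢new w≡1+m o≤m ∷ o∉path) ∷ All.map (new≢old w≡1+m) path-bounded ∷ path-unique
    ; pool-unique   = pool-unique
    ; pool-off-path = All.zipWith (λ { (o≢v , v≤m , v∉path) → (o≢v ∘ sym) ∷ old≢new w≡1+m v≤m ∷ v∉path })
                                  (o∉pool , All.zip (pool-bounded , pool-off-path))
    ; path-bounded  = ℕ.m≤n⇒m≤1+n o≤m ∷ ℕ.≤-reflexive w≡1+m ∷ Bounded-suc path-bounded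
    ; pool-bounded  = Bounded-suc pool-bounded
    ; path-linked   = Adj-sym (w-adj o≤m) ∷ w-adj (All.head path-bounded) ∷ path-linked
    ; covers        = cong suc (trans (sym (ℕ.+-suc (length (end ∷ rest)) (length pool))) covers)
    ; pool-size     = sym (trans (cong h prefix)
                                 (h-∷ʳ-true-pred (take m s) (suc (length pool)) (sym pool-size)))
    ; path-long     = subst (λ n → n ≤ length (o ∷ w ∷ end ∷ rest))
                        (sym (cong suc (trans (cong ones prefix) (ones-++-true∷ (take m s) [] refl))))
                        (s≤s (ℕ.m≤n⇒m≤1+n path-long))
    }

  extend : ∀ {m} → PathWithPool m → (w : Vertex s) → toℕ w ≡ suc m →
           take (suc m) s ≡ take m s ∷ʳ digit s (suc m) → PathWithPool (suc m)
  extend {m} P w w≡1+m prefix with digit s (suc m) in w-digit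
  ... | false = extend-isolated P w w≡1+m prefix
  ... | true  = extend-dominating P w w≡1+m (Adj-new-dominating w≡1+m w-digit) prefix

  path-up-to : ∀ m → m ≤ length s → PathWithPool m
  path-up-to zero _ = record
    { end = Fin.zero ; rest = [] ; pool = []
    ; path-unique = [] ∷ [] ; pool-unique = [] ; pool-off-path = []
    ; path-bounded = z≤n ∷ [] ; pool-bounded = [] ; path-linked = [-]
    ; covers = refl ; pool-size = refl ; path-long = s≤s z≤n
    }
  path-up-to (suc m) m<n = extend (path-up-to m (ℕ.<⇒≤ m<n))
    (fromℕ< (s≤s m<n)) (toℕ-fromℕ< (s≤s m<n)) (take-suc s m m<n)

  close-path : ∀ {m} (P : PathWithPool m) (w : Vertex s) → toℕ w ≡ suc m →
               digit s (suc m) ≡ true → 1 ≤ ones (take m s) →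
               IsCycle (Adj s) (w ∷ PathWithPool.end P ∷ PathWithPool.rest P)
  close-path {m} P w w≡1+m w-dominating has-one =
    s≤s (ℕ.≤-trans (s≤s has-one) path-long) ,
    All.map (new≢old w≡1+m) path-bounded ∷ path-unique ,
    w-adj (All.head path-bounded) ∷ path-linked ,
    Adj-sym (w-adj (All-lastOr end rest path-bounded))
    where
      open PathWithPool P
      w-adj : ∀ {v} → toℕ v ≤ m → Adj s w v
      w-adj = Adj-new-dominating w≡1+m w-dominating

long-cycle : ∀ s a b → s ≡ a ++ true ∷ b → 1 ≤ ones a →
             Σ (List (Vertex s)) λ vs → IsCycle (Adj s) vs × + length vs ≡ + (suc (length a) + 1) - h a
long-cycle s a b s≡a1b has-one =
  R ∷ end ∷ rest ,
  close-path s P R R≡1+m R-digit (subst (λ w → 1 ≤ ones w) (sym prefix) has-one) ,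
  (begin
    + suc (length (end ∷ rest))                                  ≡⟨ +[m+n]-n≡m _ (length pool) ⟨
    + (suc (length (end ∷ rest)) + length pool) - + length pool
      ≡⟨ cong₂ (λ n i → + n - i) covers′ pool-size′ ⟩
    + (suc m + 1) - h a                                          ∎)
  where
    open ≡-Reasoning
    m : ℕ
    m = length a
    m<n : m < length s
    m<n = subst (m <_) (sym (trans (cong length s≡a1b) (length-++ a))) (ℕ.m<m+n m (s≤s z≤n))
    prefix : take m s ≡ a
    prefix = trans (cong (take m) s≡a1b) (take-length-++ a (true ∷ b))
    R-digit : digit s (suc m) ≡ true
    R-digit = trans (cong (λ w → digit w (suc m)) s≡a1b) (digit-after-prefix a true b)
    P : PathWithPool s m
    P = path-up-to s m (ℕ.<⇒≤ m<n)
    open PathWithPool P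
    R : Vertex s
    R = fromℕ< (s≤s m<n)
    R≡1+m : toℕ R ≡ suc m
    R≡1+m = toℕ-fromℕ< (s≤s m<n)
    covers′ : suc (length (end ∷ rest)) + length pool ≡ suc m + 1
    covers′ = cong suc (trans covers (ℕ.+-comm 1 m))
    pool-size′ : + length pool ≡ h a
    pool-size′ = trans pool-size (cong h prefix)

-- Kinds of vertices along a cycle

data Kind : Set where
  low isolated dominating : Kind

_≟ᵏ_ : DecidableEquality Kind
low        ≟ᵏ low        = yes refl
low        ≟ᵏ isolated   = no λ ()
low        ≟ᵏ dominating = no λ ()
isolated   ≟ᵏ low        = no λ ()
isolated   ≟ᵏ isolated   = yes refl
isolated   ≟ᵏ dominating = no λ ()
dominating ≟ᵏ low        = no λ ()
dominating ≟ᵏ isolated   = no λ ()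
dominating ≟ᵏ dominating = yes refl

data Step : Kind → Kind → Set where
  low-low         : Step low low
  into-dominating : ∀ {k} → Step k dominating
  from-dominating : ∀ {k} → Step dominating k

Step-sym : ∀ {k k'} → Step k k' → Step k' k
Step-sym low-low         = low-low
Step-sym into-dominating = from-dominating
Step-sym from-dominating = into-dominating

indicator : Kind → Kind → ℕ
indicator k k' = if does (k ≟ᵏ k') then 1 else 0

count : Kind → List Kind → ℕ
count k []        = 0
count k (k' ∷ ks) = indicator k k' + count k ks

leaves-low : Kind → Kind → ℕ
leaves-low low isolated   = 1
leaves-low low dominating = 1
leaves-low _   _          = 0

exits : List Kind → ℕ
exits []            = 0
exits (k ∷ [])      = 0
exits (k ∷ k' ∷ ks) = leaves-low k k' + exits (k' ∷ ks)

length≡counts : ∀ ks → length ks ≡ count low ks + count isolated ks + count dominating ks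
length≡counts []                = refl
length≡counts (low        ∷ ks) = cong suc (length≡counts ks)
length≡counts (isolated   ∷ ks) = trans (cong suc (length≡counts ks))
  (cong (_+ count dominating ks) (sym (ℕ.+-suc (count low ks) (count isolated ks))))
length≡counts (dominating ∷ ks) = trans (cong suc (length≡counts ks))
  (sym (ℕ.+-suc (count low ks + count isolated ks) (count dominating ks)))

count-∷ʳ : ∀ k ks k' → count k (ks ∷ʳ k') ≡ count k (k' ∷ ks)
count-∷ʳ k []        k' = refl
count-∷ʳ k (k₁ ∷ ks) k' = trans (cong (indicator k k₁ ℕ.+_) (count-∷ʳ k ks k'))
                                (x∙yz≈y∙xz (indicator k k₁) (indicator k k') (count k ks))

count≡length : ∀ {k ks} → All (_≡ k) ks → count k ks ≡ length ks
count≡length                   []            = refl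
count≡length {k} {k ∷ _} (refl ∷ ps) with k ≟ᵏ k
... | yes _   = cong suc (count≡length ps)
... | no k≢k = ⊥-elim (k≢k refl)

count≡0 : ∀ {k} ks → ¬ Any (_≡ k) ks → count k ks ≡ 0
count≡0     []       _    = refl
count≡0 {k} (k' ∷ ks) no-k with k ≟ᵏ k'
... | yes k≡k' = ⊥-elim (no-k (here (sym k≡k')))
... | no _     = count≡0 ks (no-k ∘ there)

step-bound : ∀ {k k'} → Step k k' → indicator isolated k + leaves-low k k' ≤ indicator dominating k'
step-bound low-low                        = z≤n
step-bound (into-dominating {low})        = ℕ.≤-refl
step-bound (into-dominating {isolated})   = ℕ.≤-refl
step-bound (into-dominating {dominating}) = z≤n
step-bound from-dominating                = z≤n

walk-bound : ∀ {k k'} ks → Linked Step (k ∷ (ks ∷ʳ k')) →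
             count isolated (k ∷ ks) + exits (k ∷ (ks ∷ʳ k')) ≤ count dominating (ks ∷ʳ k')
walk-bound {k} {k'} [] (step ∷ [-]) =
  +-mono-≤-interchange (indicator isolated k) (leaves-low k k') 0 0 (step-bound step) z≤n
walk-bound {k} {k'} (k₁ ∷ ks) (step ∷ walk) =
  +-mono-≤-interchange (indicator isolated k) (leaves-low k k₁)
                       (count isolated (k₁ ∷ ks)) (exits (k₁ ∷ (ks ∷ʳ k')))
          (step-bound step) (walk-bound ks walk)

exits-∷ : ∀ k ks → exits ks ≤ exits (k ∷ ks)
exits-∷ k []        = z≤n
exits-∷ k (k' ∷ ks) = ℕ.m≤n+m (exits (k' ∷ ks)) (leaves-low k k')

exit-after-low : ∀ {ks} → Any (_≢ low) ks → 1 ≤ exits (low ∷ ks)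
exit-after-low {low        ∷ _} (here low≢low) = ⊥-elim (low≢low refl)
exit-after-low {low        ∷ _} (there p)      = exit-after-low p
exit-after-low {isolated   ∷ _} _              = s≤s z≤n
exit-after-low {dominating ∷ _} _              = s≤s z≤n

exit-before-non-low : ∀ {ks k} → Any (_≡ low) ks → k ≢ low → 1 ≤ exits (ks ∷ʳ k)
exit-before-non-low {_ ∷ ks} (here refl) k≢low = exit-after-low (Any.++⁺ʳ ks (here k≢low))
exit-before-non-low {k₁ ∷ ks} {k} (there p) k≢low =
  ℕ.≤-trans (exit-before-non-low p k≢low) (exits-∷ k₁ (ks ∷ʳ k))

cyclic-exit : ∀ k ks → Any (_≡ low) (k ∷ ks) → Any (_≢ low) (k ∷ ks) → 1 ≤ exits (k ∷ (ks ∷ʳ k))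
cyclic-exit low        ks _         (here low≢low) = ⊥-elim (low≢low refl)
cyclic-exit low        ks _         (there p)      = exit-after-low (Any.++⁺ˡ p)
cyclic-exit isolated   ks (there p) _              =
  ℕ.≤-trans (exit-before-non-low p λ ()) (exits-∷ isolated (ks ∷ʳ isolated))
cyclic-exit dominating ks (there p) _              =
  ℕ.≤-trans (exit-before-non-low p λ ()) (exits-∷ dominating (ks ∷ʳ dominating))

cyclic-isolated≤dominating : ∀ k ks → Linked Step (k ∷ (ks ∷ʳ k)) →
                       count isolated (k ∷ ks) + exits (k ∷ (ks ∷ʳ k)) ≤ count dominating (k ∷ ks)
cyclic-isolated≤dominating k ks closed =
  subst (count isolated (k ∷ ks) + exits (k ∷ (ks ∷ʳ k)) ≤_)
        (count-∷ʳ dominating ks k) (walk-bound ks closed)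

cyclic-isolated<dominating : ∀ k ks → Linked Step (k ∷ (ks ∷ʳ k)) →
                             Any (_≡ low) (k ∷ ks) → Any (_≢ low) (k ∷ ks) →
                             count isolated (k ∷ ks) < count dominating (k ∷ ks)
cyclic-isolated<dominating k ks closed some-low some-other = begin
  suc I                         ≡⟨ ℕ.+-comm 1 I ⟩
  I + 1                         ≤⟨ ℕ.+-monoʳ-≤ I (cyclic-exit k ks some-low some-other) ⟩
  I + exits (k ∷ (ks ∷ʳ k))     ≤⟨ cyclic-isolated≤dominating k ks closed ⟩
  count dominating (k ∷ ks)     ∎
  where
    open ℕ.≤-Reasoning
    I : ℕ
    I = count isolated (k ∷ ks)

cyclic-length≤ : ∀ {t u} k ks → Linked Step (k ∷ (ks ∷ʳ k)) →
                 count low (k ∷ ks) ≤ suc t → count dominating (k ∷ ks) ≤ suc u →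
                 length (k ∷ ks) ≤ suc t + (u + suc u)
cyclic-length≤ {t} {u} k ks closed L≤1+t D≤1+u =
  by-cases (all? (_≟ᵏ low) (k ∷ ks)) (any? (_≟ᵏ low) (k ∷ ks))
  where
    open ℕ.≤-Reasoning
    L I D : ℕ
    L = count low (k ∷ ks)
    I = count isolated (k ∷ ks)
    D = count dominating (k ∷ ks)
    by-cases : Dec (All (_≡ low) (k ∷ ks)) → Dec (Any (_≡ low) (k ∷ ks)) →
               length (k ∷ ks) ≤ suc t + (u + suc u)
    by-cases (yes all-low) _ = begin
      length (k ∷ ks)       ≡⟨ count≡length all-low ⟨
      L                     ≤⟨ L≤1+t ⟩
      suc t                 ≤⟨ ℕ.m≤m+n (suc t) (u + suc u) ⟩
      suc t + (u + suc u)   ∎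
    by-cases (no _) (no no-low) = begin
      length (k ∷ ks)       ≡⟨ length≡counts (k ∷ ks) ⟩
      L + I + D             ≡⟨ cong (λ n → n + I + D) (count≡0 (k ∷ ks) no-low) ⟩
      I + D                 ≤⟨ ℕ.+-monoˡ-≤ D (ℕ.m+n≤o⇒m≤o I (cyclic-isolated≤dominating k ks closed)) ⟩
      D + D                 ≤⟨ ℕ.+-mono-≤ D≤1+u D≤1+u ⟩
      suc u + suc u         ≤⟨ s≤s (ℕ.m≤n+m (u + suc u) t) ⟩
      suc t + (u + suc u)   ∎
    by-cases (no not-all-low) (yes some-low) = begin
      length (k ∷ ks)       ≡⟨ length≡counts (k ∷ ks) ⟩
      L + I + D             ≤⟨ ℕ.+-mono-≤ (ℕ.+-mono-≤ L≤1+t I≤u) D≤1+u ⟩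
      suc t + u + suc u     ≡⟨ ℕ.+-assoc (suc t) u (suc u) ⟩
      suc t + (u + suc u)   ∎
      where
        I≤u : I ≤ u
        I≤u = ℕ.≤-pred (ℕ.≤-trans (cyclic-isolated<dominating k ks closed some-low
                                     (¬All⇒Any¬ (_≟ᵏ low) (k ∷ ks) not-all-low)) D≤1+u)

count-map≤length : ∀ {A : Set} (f : A → Kind) k {xs ys : List A} → Unique xs →
                   (∀ {x} → x ∈ xs → f x ≡ k → x ∈ ys) → count k (map f xs) ≤ length ys
count-map≤length f k {[]}     _                     _        = z≤n
count-map≤length f k {x ∷ xs} {ys} (x∉xs ∷ xs-unique) included with k ≟ᵏ f x
... | no _    = count-map≤length f k xs-unique (included ∘ there)
... | yes k≡fx with ys' , length≡ , keep ← ∈-remove (included (here refl) (sym k≡fx)) =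
  subst (suc (count k (map f xs)) ≤_) (sym length≡)
    (s≤s (count-map≤length f k xs-unique
            λ x'∈xs fx'≡k → keep (included (there x'∈xs) fx'≡k)
                                 (λ x'≡x → All.lookup x∉xs x'∈xs (sym x'≡x))))

onePositions : ℕ → List Bool → List ℕ
onePositions i []           = []
onePositions i (true  ∷ xs) = i ∷ onePositions (suc i) xs
onePositions i (false ∷ xs) = onePositions (suc i) xs

length-onePositions : ∀ i xs → length (onePositions i xs) ≡ ones xs
length-onePositions i []           = refl
length-onePositions i (true  ∷ xs) = cong suc (length-onePositions (suc i) xs)
length-onePositions i (false ∷ xs) = length-onePositions (suc i) xs

suc∈onePositions : ∀ {v i} xs → v ∈ onePositions i xs → suc v ∈ onePositions (suc i) xs
suc∈onePositions (true  ∷ xs) (here refl) = here refl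
suc∈onePositions (true  ∷ xs) (there v∈) = there (suc∈onePositions xs v∈)
suc∈onePositions (false ∷ xs) v∈          = suc∈onePositions xs v∈

digit⇒∈onePositions : ∀ xs v → digit xs v ≡ true → v ∈ onePositions 1 xs
digit⇒∈onePositions (true  ∷ xs) (suc zero)    _       = here refl
digit⇒∈onePositions (true  ∷ xs) (suc (suc j)) v-digit =
  there (suc∈onePositions xs (digit⇒∈onePositions xs (suc j) v-digit))
digit⇒∈onePositions (false ∷ xs) (suc (suc j)) v-digit =
  suc∈onePositions xs (digit⇒∈onePositions xs (suc j) v-digit)

digit-++⇒∈onePositions : ∀ p q v → digit (p ++ q) v ≡ true → suc (length p) ≤ v →
                         v ∈ onePositions (suc (length p)) q
digit-++⇒∈onePositions []      q v             v-digit _         = digit⇒∈onePositions q v v-digit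
digit-++⇒∈onePositions (x ∷ p) q (suc (suc j)) v-digit (s≤s p<j) =
  suc∈onePositions q (digit-++⇒∈onePositions p q (suc j) v-digit p<j)

module Kinds (s : List Bool) (i : ℕ) where

  kind : ℕ → Kind
  kind v with v ℕ.≤? i | digit s v
  ... | yes _ | _     = low
  ... | no _  | true  = dominating
  ... | no _  | false = isolated

  kind-≤ : ∀ {v} → v ≤ i → kind v ≡ low
  kind-≤ {v} v≤i with v ℕ.≤? i | digit s v
  ... | yes _   | _ = refl
  ... | no v≰i | _ = ⊥-elim (v≰i v≤i)

  kind-> : ∀ {v} → i < v → digit s v ≡ true → kind v ≡ dominating
  kind-> {v} i<v v-digit with v ℕ.≤? i | digit s v
  ... | yes v≤i | _    = ⊥-elim (ℕ.<⇒≱ i<v v≤i)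
  ... | no _    | true = refl

  kind≡low⇒≤ : ∀ {v} → kind v ≡ low → v ≤ i
  kind≡low⇒≤ {v} _ with v ℕ.≤? i | digit s v
  ... | yes v≤i | _ = v≤i
  kind≡low⇒≤ {v} () | no _ | true
  kind≡low⇒≤ {v} () | no _ | false

  kind≡dominating⇒ : ∀ {v} → kind v ≡ dominating → i < v × digit s v ≡ true
  kind≡dominating⇒ {v} _ with v ℕ.≤? i | digit s v
  ... | no v≰i | true = ℕ.≰⇒> v≰i , refl
  kind≡dominating⇒ {v} () | yes _ | _
  kind≡dominating⇒ {v} () | no _  | false

  kind-later : ∀ {u v} → u ≤ v → digit s v ≡ true → Step (kind u) (kind v)
  kind-later {u} {v} u≤v v-digit with ℕ.≤-<-connex v i
  ... | inj₁ v≤i rewrite kind-≤ v≤i | kind-≤ (ℕ.≤-trans u≤v v≤i) = low-low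
  ... | inj₂ i<v rewrite kind-> i<v v-digit = into-dominating

  kind-step : ∀ u v → Edge s u v → Step (kind u) (kind v)
  kind-step u v edge with ℕ.≤-total u v
  ... | inj₁ u≤v = kind-later u≤v (trans (cong (digit s) (sym (ℕ.m≤n⇒m⊔n≡n u≤v))) edge)
  ... | inj₂ v≤u = Step-sym (kind-later v≤u (trans (cong (digit s) (sym (ℕ.m≥n⇒m⊔n≡m v≤u))) edge))

  count-low≤ : ∀ {vs} → Unique vs → count low (map kind vs) ≤ suc i
  count-low≤ {vs} vs-unique = subst (count low (map kind vs) ≤_) (length-upTo (suc i))
    (count-map≤length kind low vs-unique (λ _ kind≡low → ∈-applyUpTo⁺ id (s≤s (kind≡low⇒≤ kind≡low))))

  count-dominating≤ : ∀ p q {vs} → s ≡ p ++ q → length p ≡ i → Unique vs →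
                      count dominating (map kind vs) ≤ ones q
  count-dominating≤ p q {vs} s≡p++q refl vs-unique =
    subst (count dominating (map kind vs) ≤_) (length-onePositions _ q)
    (count-map≤length kind dominating vs-unique λ _ kind≡dominating →
      let i<v , v-digit = kind≡dominating⇒ kind≡dominating in
      digit-++⇒∈onePositions p q _ (subst (λ w → digit w _ ≡ true) s≡p++q v-digit) i<v)

  cycle-length≤ : ∀ {u} v vs → Unique (v ∷ vs) → Linked (Edge s) (v ∷ vs) → Edge s (lastOr v vs) v →
                  count dominating (map kind (v ∷ vs)) ≤ suc u → length (v ∷ vs) ≤ suc i + (u + suc u)
  cycle-length≤ {u} v vs vs-unique linked closing dominating≤ =
    subst (_≤ suc i + (u + suc u)) (length-map kind (v ∷ vs))
      (cyclic-length≤ (kind v) (map kind vs) kinds-linked (count-low≤ vs-unique) dominating≤)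
    where
      kinds-linked : Linked Step (kind v ∷ (map kind vs ∷ʳ kind v))
      kinds-linked = subst (Linked Step) (cong (kind v ∷_) (map-++ kind vs (v ∷ [])))
        (Linked.map⁺ (Linked.map (λ {u} {w} → kind-step u w) (Linked-∷ʳ vs linked closing)))

-- No cycle is longer

excess≤ : ∀ q L C → zeros q + L ≤ C + ones q → excess q ℤ.≤ + C - + L
excess≤ q L C z+L≤C+o =
  subst₂ ℤ._≤_ (cancelʳ (+ z) (+ o) (+ L)) (cancelˡ (+ C) (+ o) (+ L))
    (ℤ.+-monoˡ-≤ (ℤ.- (+ o ℤ.+ + L))
      (subst₂ ℤ._≤_ (ℤ.pos-+ z L) (ℤ.pos-+ C o) (ℤ.+≤+ z+L≤C+o)))
  where
    z o : ℕ
    z = zeros q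
    o = ones q
    cancelʳ : ∀ (x y w : ℤ) → (x ℤ.+ w) - (y ℤ.+ w) ≡ x - y
    cancelʳ = solve-∀
    cancelˡ : ∀ (x y w : ℤ) → (x ℤ.+ y) - (y ℤ.+ w) ≡ x - w
    cancelˡ = solve-∀

h+cycle-length≤ : ∀ {s} a b → s ≡ a ++ true ∷ b → ones b ≡ 0 →
                  ∀ v vs → Unique (v ∷ vs) → Linked (Edge s) (v ∷ vs) → Edge s (lastOr v vs) v →
                  h a ℤ.≤ + (suc (length a) + 1) - + length (v ∷ vs)
h+cycle-length≤ {s} a b s≡a1b no-ones v vs vs-unique linked closing = h-lub a suffix-bound
  where
    suffix-bound : ∀ p q → a ≡ p ++ q → excess q ℤ.≤ + (suc (length a) + 1) - + length (v ∷ vs)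
    suffix-bound p q refl = excess≤ q (length (v ∷ vs)) (suc (length a) + 1) (begin
      zeros q + length (v ∷ vs)                        ≤⟨ ℕ.+-monoʳ-≤ (zeros q) cycle-bound ⟩
      zeros q + (suc (length p) + (ones q + suc (ones q)))
        ≡⟨ rearrange (zeros q) (length p) (ones q) ⟩
      suc (length p + (zeros q + ones q)) + 1 + ones q
        ≡⟨ cong (λ n → suc (length p + n) + 1 + ones q) (zeros+ones≡length q) ⟩
      suc (length p + length q) + 1 + ones q
        ≡⟨ cong (λ n → suc n + 1 + ones q) (sym (length-++ p)) ⟩
      suc (length (p ++ q)) + 1 + ones q ∎)
      where
        open ℕ.≤-Reasoning
        open Kinds s (length p)
        rearrange : ∀ z l u → z + (suc l + (u + suc u)) ≡ suc (l + (z + u)) + 1 + u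
        rearrange = ℕ-solve-∀
        cycle-bound : length (v ∷ vs) ≤ suc (length p) + (ones q + suc (ones q))
        cycle-bound = cycle-length≤ v vs vs-unique linked closing
          (subst (count dominating (map kind (v ∷ vs)) ≤_) (ones-++-true∷ q b no-ones)
            (count-dominating≤ p (q ++ true ∷ b) (trans s≡a1b (++-assoc p q (true ∷ b))) refl vs-unique))

h+IsCycle-length≤ : ∀ {s} a b → s ≡ a ++ true ∷ b → ones b ≡ 0 →
                    ∀ vs → IsCycle (Adj s) vs → h a ℤ.≤ + (suc (length a) + 1) - + length vs
h+IsCycle-length≤ {s} a b s≡a1b no-ones (v ∷ vs) (_ , vs-unique , linked , closing) =
  subst (λ n → h a ℤ.≤ + (suc (length a) + 1) - + suc n) (length-map toℕ vs)
    (h+cycle-length≤ a b s≡a1b no-ones (toℕ v) (map toℕ vs)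
      (Unique.map⁺ toℕ-injective vs-unique)
      (Linked.map⁺ (Linked.map proj₂ linked))
      (subst (λ u → Edge s u (toℕ v)) (sym (lastOr-map toℕ v vs)) (proj₂ closing)))

mainTheorem8 : (s : List Bool) → 2 ≤ ones s →
    Σ ℕ (λ ψ → IsLongestCycleLength (Adj s) ψ
      × (+ ψ) ≡ (+ (r s + 1)) - h (take (r s ∸ 1) s))
mainTheorem8 s two-ones
  with lastOneSplit a b s≡a1b no-ones r≡1+m ← last-one-split 0 s (ℕ.≤-trans (s≤s z≤n) two-ones)
  with vs , vs-cycle , length-vs ← long-cycle s a b s≡a1b
         (ℕ.≤-pred (subst (2 ≤_) (trans (cong ones s≡a1b) (ones-++-true∷ a b no-ones)) two-ones))
  = length vs , ((vs , vs-cycle , refl) , longest) ,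
    trans length-vs (cong₂ (λ n w → + (n + 1) - h w) (sym r≡1+m) (sym prefix))
  where
    prefix : take (r s ∸ 1) s ≡ a
    prefix = trans (cong (λ n → take (n ∸ 1) s) r≡1+m)
                   (trans (cong (take (length a)) s≡a1b) (take-length-++ a (true ∷ b)))
    longest : ∀ ws → IsCycle (Adj s) ws → length ws ≤ length vs
    longest ws ws-cycle = ℤ.drop‿+≤+ (subst (+ length ws ℤ.≤_) (sym length-vs)
      (i≤j-k⇒k≤j-i {j = + (suc (length a) + 1)} (h+IsCycle-length≤ a b s≡a1b no-ones ws ws-cycle)))
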